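{- Let $G$ be a group, $M$ a $\mathbb{Z}[G]$-module, and $P \in M$ an almost fixed element. Then: (1) for every $\sigma \in G$, $\sigma P$ is almost fixed; (2) if $g \in G$ and $(g-1)^2 P = 0$, then $(g-1)P = 0$.
   Context: An element $P$ of a $\mathbb{Z}[G]$-module $M$ is almost fixed (by $G$) if whenever $g,h \in G$ satisfy $(g+h-2)P = 0$, one has $(g-1)P = (h-1)P = 0$. -}

module Defs where

open import Level using (Level; _⊔_; suc)
open import Algebra.Bundles using (Group; AbelianGroup)
open import Relation.Binary.Core using (_Preserves_⟶_)
open import Data.Product using (_×_)

-- A Z[G]-module: an abelian group M with a left action of G by additive
-- endomorphisms (equivalently, a module over the integral group ring Z[G]).
record ZGModule {g ℓg : Level} (G : Group g ℓg) (m ℓm : Level)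
       : Set (g ⊔ ℓg ⊔ suc (m ⊔ ℓm)) where
  module G = Group G
  field
    M : AbelianGroup m ℓm
  open AbelianGroup M public
    renaming (Carrier to Elt; _∙_ to _+_; _⁻¹ to -_; ε to 0#)
  infixr 8 _·_
  field
    _·_      : G.Carrier → Elt → Elt
    ·-cong   : ∀ {x y} {P Q} → x G.≈ y → P ≈ Q → x · P ≈ y · Q
    ·-identity : ∀ P → G.ε · P ≈ P
    ·-assoc  : ∀ x y P → (x G.∙ y) · P ≈ x · (y · P)
    ·-distrib-+ : ∀ x P Q → x · (P + Q) ≈ x · P + x · Q

  [_-1]_ : G.Carrier → Elt → Elt
  [ x -1] P = x · P - P

  [_+_-2]_ : G.Carrier → G.Carrier → Elt → Elt
  [ x + y -2] P = ((x · P + y · P) - P) - P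

  AlmostFixed : Elt → Set (g ⊔ ℓm)
  AlmostFixed P = ∀ x y → [ x + y -2] P ≈ 0# → ([ x -1] P ≈ 0#) × ([ y -1] P ≈ 0#)

-- Conjugating by σ turns the hypothesis on σP into the same hypothesis on P
-- for the conjugates σ⁻¹xσ, σ⁻¹yσ; since each element of G acts by an
-- automorphism, vanishing is transported back. For (2), (g - 1)² = g (g + g⁻¹ - 2)
-- in Z[G], so (g - 1)² P = 0 gives (g + g⁻¹ - 2) P = 0 and almost-fixedness applies.
module Submission where

open import Defs
open import Level using (Level)
open import Algebra.Bundles using (Group; AbelianGroup)
open import Data.Product using (_×_; _,_; proj₁; map)
import Algebra.Properties.AbelianGroup as AbelianGroupProperties
import Algebra.Properties.CommutativeSemigroup as CommutativeSemigroupProperties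
import Relation.Binary.Reasoning.Setoid as SetoidReasoning

module ZGModuleProperties {g ℓg m ℓm : Level} {G : Group g ℓg} (Mod : ZGModule G m ℓm) where
  open ZGModule Mod
  open AbelianGroupProperties M
  open CommutativeSemigroupProperties (AbelianGroup.commutativeSemigroup M)
    using (interchange)
  open SetoidReasoning setoid

  ·-zeroʳ : ∀ x → x · 0# ≈ 0#
  ·-zeroʳ x = identityʳ-unique (x · 0#) (x · 0#)
    (trans (sym (·-distrib-+ x 0# 0#)) (·-cong G.refl (identityʳ 0#)))

  ·-preserves-0 : ∀ x {Q} → Q ≈ 0# → x · Q ≈ 0#
  ·-preserves-0 x Q≈0 = trans (·-cong G.refl Q≈0) (·-zeroʳ x)

  ·-cancelˡ : ∀ x Q → (x G.⁻¹) · (x · Q) ≈ Q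
  ·-cancelˡ x Q = begin
    (x G.⁻¹) · (x · Q)  ≈⟨ sym (·-assoc (x G.⁻¹) x Q) ⟩
    (x G.⁻¹ G.∙ x) · Q  ≈⟨ ·-cong (G.inverseˡ x) refl ⟩
    G.ε · Q             ≈⟨ ·-identity Q ⟩
    Q                   ∎

  ·-reflects-0 : ∀ x {Q} → x · Q ≈ 0# → Q ≈ 0#
  ·-reflects-0 x {Q} xQ≈0 = trans (sym (·-cancelˡ x Q)) (·-preserves-0 (x G.⁻¹) xQ≈0)

  ·-⁻¹ : ∀ x P → x · (- P) ≈ - (x · P)
  ·-⁻¹ x P = inverseʳ-unique (x · P) (x · (- P))
    (trans (sym (·-distrib-+ x P (- P))) (·-preserves-0 x (inverseʳ P)))

  ·-distrib-- : ∀ x P Q → x · (P - Q) ≈ x · P - x · Q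
  ·-distrib-- x P Q = trans (·-distrib-+ x P (- Q)) (∙-congˡ (·-⁻¹ x Q))

  conj : G.Carrier → G.Carrier → G.Carrier
  conj σ x = (σ G.⁻¹ G.∙ x) G.∙ σ

  conj-· : ∀ σ x P → conj σ x · P ≈ (σ G.⁻¹) · (x · (σ · P))
  conj-· σ x P = trans (·-assoc _ σ P) (·-assoc _ x _)

  conj-[-1] : ∀ σ x P → (σ G.⁻¹) · ([ x -1] (σ · P)) ≈ [ conj σ x -1] P
  conj-[-1] σ x P = begin
    (σ G.⁻¹) · (x · (σ · P) - σ · P)               ≈⟨ ·-distrib-- (σ G.⁻¹) _ _ ⟩
    (σ G.⁻¹) · (x · (σ · P)) - (σ G.⁻¹) · (σ · P)  ≈⟨ ∙-cong (sym (conj-· σ x P)) (⁻¹-cong (·-cancelˡ σ P)) ⟩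
    conj σ x · P - P                               ∎

  ·-distrib-[+-2] : ∀ z x y Q →
    z · ([ x + y -2] Q) ≈ ((z · (x · Q) + z · (y · Q)) - z · Q) - z · Q
  ·-distrib-[+-2] z x y Q = begin
    z · (((x · Q + y · Q) - Q) - Q)             ≈⟨ ·-distrib-- z _ Q ⟩
    z · ((x · Q + y · Q) - Q) - z · Q           ≈⟨ ∙-congʳ (·-distrib-- z _ Q) ⟩
    (z · (x · Q + y · Q) - z · Q) - z · Q       ≈⟨ ∙-congʳ (∙-congʳ (·-distrib-+ z _ _)) ⟩
    ((z · (x · Q) + z · (y · Q)) - z · Q) - z · Q ∎

  conj-[+-2] : ∀ σ x y P → (σ G.⁻¹) · ([ x + y -2] (σ · P)) ≈ [ conj σ x + conj σ y -2] P
  conj-[+-2] σ x y P = trans (·-distrib-[+-2] (σ G.⁻¹) x y (σ · P))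
    (∙-cong (∙-cong (∙-cong (sym (conj-· σ x P)) (sym (conj-· σ y P)))
                    (⁻¹-cong (·-cancelˡ σ P)))
            (⁻¹-cong (·-cancelˡ σ P)))

  ⁻¹·[-1]²≈[+⁻¹-2] : ∀ x P → (x G.⁻¹) · ([ x -1] ([ x -1] P)) ≈ [ x + (x G.⁻¹) -2] P
  ⁻¹·[-1]²≈[+⁻¹-2] x P = begin
    x⁻¹ · (x · (a - P) - (a - P))          ≈⟨ ·-distrib-- x⁻¹ _ _ ⟩
    x⁻¹ · (x · (a - P)) - x⁻¹ · (a - P)    ≈⟨ ∙-cong (·-cancelˡ x _) (⁻¹-cong (·-distrib-- x⁻¹ a P)) ⟩
    (a - P) - (x⁻¹ · a - b)                ≈⟨ ∙-congˡ (⁻¹-cong (∙-congʳ (·-cancelˡ x P))) ⟩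
    (a - P) - (P - b)                      ≈⟨ ∙-congˡ (⁻¹-anti-homo‿- P b) ⟩
    (a - P) + (b - P)                      ≈⟨ interchange a (- P) b (- P) ⟩
    (a + b) + (- P + - P)                  ≈⟨ sym (assoc _ _ _) ⟩
    ((a + b) - P) - P                      ∎
    where
    x⁻¹ = x G.⁻¹
    a = x · P
    b = x⁻¹ · P

  almostFixed-· : ∀ {P} → AlmostFixed P → ∀ σ → AlmostFixed (σ · P)
  almostFixed-· {P} af σ x y vanishes = map back back
    (af (conj σ x) (conj σ y)
        (trans (sym (conj-[+-2] σ x y P)) (·-preserves-0 (σ G.⁻¹) vanishes)))
    where
    back : ∀ {z} → [ conj σ z -1] P ≈ 0# → [ z -1] (σ · P) ≈ 0#
    back {z} fixed = ·-reflects-0 (σ G.⁻¹) (trans (conj-[-1] σ z P) fixed)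

  almostFixed-[-1]²≈0⇒[-1]≈0 : ∀ {P} → AlmostFixed P →
    ∀ x → [ x -1] ([ x -1] P) ≈ 0# → [ x -1] P ≈ 0#
  almostFixed-[-1]²≈0⇒[-1]≈0 {P} af x vanishes = proj₁ (af x (x G.⁻¹)
    (trans (sym (⁻¹·[-1]²≈[+⁻¹-2] x P)) (·-preserves-0 (x G.⁻¹) vanishes)))

lemma2p4 : ∀ {g ℓg m ℓm : Level} (G : Group g ℓg) (Mod : ZGModule G m ℓm)
    → let open ZGModule Mod in
    ∀ (P : Elt) → AlmostFixed P
    → ((σ : Group.Carrier G) → AlmostFixed (σ · P))
    × ((x : Group.Carrier G) → [ x -1] ([ x -1] P) ≈ 0# → [ x -1] P ≈ 0#)
lemma2p4 G Mod P af = almostFixed-· af , almostFixed-[-1]²≈0⇒[-1]≈0 af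
  where open ZGModuleProperties Mod
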